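{- Let $n,k$ be integers with $1\le k<n/2$. Then $\mathrm{GP}(n,k)$ is trivially unstable if and only if it is bipartite, which holds if and only if $n$ is even and $k$ is odd. Moreover, if $n$ is even and $k$ is odd, then $D(\mathrm{GP}(n,k))\cong 2\,\mathrm{GP}(n,k)$ and $\mathrm{Aut}(D(\mathrm{GP}(n,k)))=\mathrm{Aut}(\mathrm{GP}(n,k))\wr S_2$.
   Context: $\mathrm{GP}(n,k)$ ($1\le k<n/2$) is the graph on $u_0,\dots,u_{n-1},v_0,\dots,v_{n-1}$ with edges $\{u_i,u_{i+1}\},\{u_i,v_i\},\{v_i,v_{i+k}\}$ (subscripts mod $n$). $D(\Gamma)$ is the canonical double cover $\Gamma\times K_2$: vertex set $V(\Gamma)\times\mathbb{Z}_2$, $(u,x)\sim(v,y)$ iff $u\sim v$ and $x\ne y$. $\Gamma$ is stable if $\mathrm{Aut}(D(\Gamma))=\mathrm{Aut}(\Gamma)\times\mathbb{Z}_2$, unstable otherwise. A graph is vertex-determining if no two distinct vertices have the same neighborhood. An unstable graph is nontrivially unstable if it is connected, non-bipartite and vertex-determining, and trivially unstable otherwise. $2\Gamma$ denotes the disjoint union of two copies of $\Gamma$. -}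

module Defs where

open import Data.Nat using (ℕ; _+_; NonZero)
open import Data.Nat.DivMod using (_%_)
open import Data.Fin using (Fin; toℕ)
open import Data.Bool using (Bool; true; false; if_then_else_; _xor_)
open import Data.Product using (Σ; _×_; _,_; proj₁)
open import Data.Sum using (_⊎_)
open import Relation.Nullary using (¬_)
open import Relation.Binary.PropositionalEquality using (_≡_; _≢_)
open import Relation.Binary.Construct.Closure.ReflexiveTransitive using (Star)
open import Function.Bundles using (_↔_; _⇔_; Inverse)

record Graph : Set₁ where
  field
    V   : Set
    Adj : V → V → Set
open Graph public

IsAut : (G : Graph) → (V G ↔ V G) → Set
IsAut G f = ∀ x y → Adj G x y ⇔ Adj G (Inverse.to f x) (Inverse.to f y)

Aut : Graph → Set
Aut G = Σ (V G ↔ V G) (IsAut G)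

autFun : (G : Graph) → Aut G → V G → V G
autFun G σ = Inverse.to (proj₁ σ)

Iso : Graph → Graph → Set
Iso G H = Σ (V G ↔ V H) λ φ →
  ∀ x y → Adj G x y ⇔ Adj H (Inverse.to φ x) (Inverse.to φ y)

-- Canonical double cover D(Γ) = Γ × K₂.
D : Graph → Graph
D G = record
  { V   = V G × Bool
  ; Adj = λ { (u , x) (v , y) → Adj G u v × x ≢ y } }

-- Disjoint union of two copies 2Γ (copy index in Bool).
Two : Graph → Graph
Two G = record
  { V   = V G × Bool
  ; Adj = λ { (u , x) (v , y) → Adj G u v × x ≡ y } }

-- Stability: every automorphism of D(Γ) lies in the natural copy of
-- Aut(Γ) × ℤ₂, i.e. is of the form (u , x) ↦ (σ u , x xor c).
Stable : Graph → Set
Stable G = ∀ (f : Aut (D G)) → Σ (Aut G) λ σ → Σ Bool λ c →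
  ∀ u x → autFun (D G) f (u , x) ≡ (autFun G σ u , x xor c)

Unstable : Graph → Set
Unstable G = ¬ Stable G

Connected : Graph → Set
Connected G = ∀ (u v : V G) → Star (Adj G) u v

Bipartite : Graph → Set
Bipartite G = Σ (V G → Bool) λ c → ∀ u v → Adj G u v → c u ≢ c v

VertexDetermining : Graph → Set
VertexDetermining G = ∀ u v → (∀ w → Adj G u w ⇔ Adj G v w) → u ≡ v

NontriviallyUnstable : Graph → Set
NontriviallyUnstable G =
  Unstable G × Connected G × ¬ Bipartite G × VertexDetermining G

-- "trivially unstable otherwise": unstable but not nontrivially so.
TriviallyUnstable : Graph → Set
TriviallyUnstable G =
  Unstable G × ¬ (Connected G × ¬ Bipartite G × VertexDetermining G)

-- Generalized Petersen graph GP(n,k).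
-- Vertices (false , i) = u_i and (true , i) = v_i, i : Fin n.

StepMod : (n s : ℕ) .{{_ : NonZero n}} → Fin n → Fin n → Set
StepMod n s i j = toℕ j ≡ (toℕ i + s) % n

GPAdj : (n k : ℕ) .{{_ : NonZero n}} → Bool × Fin n → Bool × Fin n → Set
GPAdj n k (false , i) (false , j) = StepMod n 1 i j ⊎ StepMod n 1 j i
GPAdj n k (false , i) (true  , j) = i ≡ j
GPAdj n k (true  , i) (false , j) = i ≡ j
GPAdj n k (true  , i) (true  , j) = StepMod n k i j ⊎ StepMod n k j i

GP : (n k : ℕ) .{{_ : NonZero n}} → Graph
GP n k = record { V = Bool × Fin n ; Adj = GPAdj n k }

-- Aut(D Γ) = Aut(Γ) ≀ S₂ as permutation groups, transported along an
-- isomorphism φ : D(Γ) ≅ 2Γ: a permutation h of V(2Γ) belongs to the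
-- wreath product (imprimitive action) iff h (v , i) = (σ_i v , π i)
-- with σ₀, σ₁ ∈ Aut Γ and π ∈ Sym(Bool) = S₂.
InWreath : (G : Graph) → (V G × Bool → V G × Bool) → Set
InWreath G h = Σ (Aut G) λ σ₀ → Σ (Aut G) λ σ₁ → Σ (Bool ↔ Bool) λ π →
  ∀ v i → h (v , i) ≡
    (autFun G (if i then σ₁ else σ₀) v , Inverse.to π i)

AutDIsWreath : (G : Graph) → Iso (D G) (Two G) → Set
AutDIsWreath G φ = ∀ (f : (V G × Bool) ↔ (V G × Bool)) →
  IsAut (D G) f ⇔
  InWreath G (λ w → Inverse.to (proj₁ φ)
                      (Inverse.to f (Inverse.from (proj₁ φ) w)))

-- A proper 2-colouring c of Γ gives the isomorphism D(Γ) ≅ 2Γ, (u , x) ↦ (u , x xor c u).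
-- When Γ is connected, an automorphism of 2Γ permutes the two copies and acts on each by an
-- automorphism of Γ, which is the wreath product description.  Acting by a non-identity
-- automorphism ρ on one copy only is therefore an automorphism of D(Γ) that is not of the
-- form σ × ℤ₂, so bipartite GP(n,k) are unstable.  Conversely, since GP(n,k) is connected and
-- (for n ≥ 3) vertex-determining, trivial instability forces bipartiteness.  Finally GP(n,k)
-- is bipartite iff n is even (the rim is an n-cycle) and k is odd (u₀ v₀ v_k u_k … u₀ has
-- length k + 3); for n even and k odd, i ↦ parity of i on the rim and its opposite on the
-- spokes is a proper colouring.
module Submission where

open import Defs
open import Data.Nat using (ℕ; _*_; _≤_; _<_; NonZero)
open import Data.Nat.Divisibility using (_∣_)
open import Data.Product using (Σ; _×_)
open import Relation.Nullary using (¬_)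
open import Function.Bundles using (_⇔_)

open import Data.Nat using (zero; suc; _+_; _∸_; z≤n; s≤s; >-nonZero⁻¹)
open import Data.Nat.Properties
  using (+-assoc; +-comm; +-identityʳ; +-cancelˡ-≡; +-mono-<; m<m+n; <⇒≤; <⇒≢; ≮⇒≥; _<?_;
         m<n+o⇒m∸n<o; m∸n+n≡m; ≤-<-trans; *-monoʳ-≤)
open import Data.Nat.DivMod
  using (_%_; _/_; m%n<n; m%n%n≡m%n; %-distribˡ-+; [m+n]%n≡m%n; m<n⇒m%n≡m; m≤n⇒[n∸m]%m≡n%m;
         m≡m%n+[m/n]*n)
open import Data.Nat.Divisibility using (divides; _∣?_; ∣-refl; ∣m∣n⇒∣m+n; ∣n⇒∣m*n)
open import Data.Fin using (Fin; toℕ; fromℕ<)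
open import Data.Fin.Properties using (toℕ-fromℕ<; toℕ<n; toℕ-injective)
open import Data.Bool using (Bool; true; false; not; _xor_; if_then_else_)
open import Data.Bool.Properties
  using (not-injective; not-¬; ¬-not; not-distribʳ-xor;
         xor-assoc; xor-identityʳ; xor-same; xor-inverseˡ)
open import Data.Product using (_,_; proj₁; proj₂)
open import Data.Sum using (inj₁; inj₂)
open import Data.Empty using (⊥-elim)
open import Relation.Nullary using (Dec; yes; no; ¬?; _×-dec_)
open import Relation.Nullary.Decidable using (decidable-stable)
import Relation.Nullary.Decidable as Dec
open import Relation.Binary.PropositionalEquality
  using (_≡_; _≢_; refl; sym; trans; cong; subst; subst₂; ≢-sym; module ≡-Reasoning)
open import Relation.Binary.Construct.Closure.ReflexiveTransitive using (Star; ε; _◅_; _◅◅_; reverse)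
open import Function using (_∘_)
open import Function.Bundles using (_↔_; Inverse; Injection; mk⇔; mk↔ₛ′; Equivalence)
open import Function.Construct.Identity using (↔-id; ⇔-id)
open import Function.Construct.Symmetry using (↔-sym; ⇔-sym)
open import Function.Construct.Composition using (_↔-∘_)
open import Function.Properties.Equivalence using () renaming (trans to ⇔-trans)
open import Function.Properties.Inverse using (Inverse⇒Injection)

-- Booleans and parity

xor-≡-injective : ∀ {a b} x y → a ≢ b → (x ≢ y ⇔ x xor a ≡ y xor b)
xor-≡-injective false false a≢b = mk⇔ (λ x≢x → ⊥-elim (x≢x refl)) (λ a≡b → ⊥-elim (a≢b a≡b))
xor-≡-injective false true  a≢b = mk⇔ (λ _ → ¬-not a≢b) (λ _ ())
xor-≡-injective true  false a≢b = mk⇔ (λ _ → sym (¬-not (≢-sym a≢b))) (λ _ ())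
xor-≡-injective true  true  a≢b =
  mk⇔ (λ x≢x → ⊥-elim (x≢x refl)) (λ e → ⊥-elim (a≢b (not-injective e)))

x⊕y≡x⇒y≡false : ∀ x y → x xor y ≡ x → y ≡ false
x⊕y≡x⇒y≡false x     false _ = refl
x⊕y≡x⇒y≡false false true  ()
x⊕y≡x⇒y≡false true  true  ()

≡not⇒≢ : ∀ {x y} → y ≡ not x → x ≢ y
≡not⇒≢ y≡not-x x≡y = not-¬ refl (trans x≡y y≡not-x)

injective⇒involutive : (g : Bool → Bool) → g false ≢ g true → ∀ b → g (g b) ≡ b
injective⇒involutive g g-inj false with g false in e₀
... | false = e₀
... | true  = ¬-not (≢-sym g-inj)
injective⇒involutive g g-inj true with g true in e₁
... | true  = e₁
... | false = ¬-not g-inj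

isOdd : ℕ → Bool
isOdd 0             = false
isOdd 1             = true
isOdd (suc (suc m)) = isOdd m

isOdd-suc : ∀ m → isOdd (suc m) ≡ not (isOdd m)
isOdd-suc 0             = refl
isOdd-suc 1             = refl
isOdd-suc (suc (suc m)) = isOdd-suc m

isOdd-+ : ∀ m n → isOdd (m + n) ≡ isOdd m xor isOdd n
isOdd-+ 0             n = refl
isOdd-+ 1             n = isOdd-suc n
isOdd-+ (suc (suc m)) n = isOdd-+ m n

2∣⇒isOdd≡false : ∀ {m} → 2 ∣ m → isOdd m ≡ false
2∣⇒isOdd≡false (divides zero    refl) = refl
2∣⇒isOdd≡false (divides (suc q) refl) = 2∣⇒isOdd≡false (divides q refl)

isOdd≡false⇒2∣ : ∀ m → isOdd m ≡ false → 2 ∣ m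
isOdd≡false⇒2∣ 0             _    = divides 0 refl
isOdd≡false⇒2∣ (suc (suc m)) even = ∣m∣n⇒∣m+n ∣-refl (isOdd≡false⇒2∣ m even)

¬2∣⇒isOdd≡true : ∀ m → ¬ 2 ∣ m → isOdd m ≡ true
¬2∣⇒isOdd≡true m odd with isOdd m in e
... | true  = refl
... | false = ⊥-elim (odd (isOdd≡false⇒2∣ m e))

isOdd-% : ∀ m n .{{_ : NonZero n}} → 2 ∣ n → isOdd (m % n) ≡ isOdd m
isOdd-% m n 2∣n = sym (begin
  isOdd m                               ≡⟨ cong isOdd (m≡m%n+[m/n]*n m n) ⟩
  isOdd (m % n + m / n * n)             ≡⟨ isOdd-+ (m % n) (m / n * n) ⟩
  isOdd (m % n) xor isOdd (m / n * n)   ≡⟨ cong (isOdd (m % n) xor_) (2∣⇒isOdd≡false (∣n⇒∣m*n (m / n) 2∣n)) ⟩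
  isOdd (m % n) xor false               ≡⟨ xor-identityʳ _ ⟩
  isOdd (m % n)                         ∎)
  where open ≡-Reasoning

-- Adjacency-preserving maps, isomorphisms and walks

PreservesAdjacency : (G : Graph) → (V G → V G) → Set
PreservesAdjacency G h = ∀ x y → Adj G x y ⇔ Adj G (h x) (h y)

PreservesAdjacency-cong : ∀ G {h h′} → (∀ x → h x ≡ h′ x) →
                          PreservesAdjacency G h → PreservesAdjacency G h′
PreservesAdjacency-cong G {h} {h′} h≗h′ h-adj x y =
  subst₂ (λ a b → Adj G x y ⇔ Adj G a b) (h≗h′ x) (h≗h′ y) (h-adj x y)

Iso-sym : ∀ {G H} → Iso G H → Iso H G
Iso-sym {G} {H} (φ , φ-adj) = ↔-sym φ , λ x y →
  subst₂ (λ a b → Adj H a b ⇔ Adj G (from x) (from y))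
         (strictlyInverseˡ x) (strictlyInverseˡ y) (⇔-sym (φ-adj (from x) (from y)))
  where open Inverse φ

conjugate-preservesAdjacency : ∀ {G H} (φ : Iso G H) (h : V H → V H) →
  PreservesAdjacency H h → PreservesAdjacency G (Inverse.from (proj₁ φ) ∘ h ∘ Inverse.to (proj₁ φ))
conjugate-preservesAdjacency {G} {H} φ h h-adj x y =
  ⇔-trans (proj₂ φ x y) (⇔-trans (h-adj (to x) (to y)) (proj₂ (Iso-sym {G} {H} φ) (h (to x)) (h (to y))))
  where open Inverse (proj₁ φ)

module _ (G : Graph) where

  walk : (f : ℕ → V G) → (∀ m → Adj G (f m) (f (suc m))) → ∀ m → Star (Adj G) (f 0) (f m)
  walk f step zero    = ε
  walk f step (suc m) = walk f step m ◅◅ (step m ◅ ε)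

  connected-from : (∀ {u v} → Adj G u v → Adj G v u) →
                   (v₀ : V G) → (∀ v → Star (Adj G) v₀ v) → Connected G
  connected-from adj-sym v₀ reach u v = reverse adj-sym (reach u) ◅◅ reach v

  colour-alternates : ((c , proper) : Bipartite G) →
    (f : ℕ → V G) → (∀ m → Adj G (f m) (f (suc m))) → ∀ m → c (f m) ≡ c (f 0) xor isOdd m
  colour-alternates (c , proper) f step zero    = sym (xor-identityʳ _)
  colour-alternates (c , proper) f step (suc m) = begin
    c (f (suc m))                   ≡⟨ ¬-not (≢-sym (proper _ _ (step m))) ⟩
    not (c (f m))                   ≡⟨ cong not (colour-alternates (c , proper) f step m) ⟩
    not (c (f 0) xor isOdd m)       ≡⟨ not-distribʳ-xor (c (f 0)) (isOdd m) ⟩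
    c (f 0) xor not (isOdd m)       ≡⟨ cong (c (f 0) xor_) (sym (isOdd-suc m)) ⟩
    c (f 0) xor isOdd (suc m)       ∎
    where open ≡-Reasoning

-- Automorphisms of two copies of a connected graph

inWreath⇒preservesAdjacency : (G : Graph) (h : V G × Bool → V G × Bool) →
                              InWreath G h → PreservesAdjacency (Two G) h
inWreath⇒preservesAdjacency G h (σ₀ , σ₁ , π , h≡) (v , i) (w , j) =
  subst₂ (λ a b → Adj (Two G) (v , i) (w , j) ⇔ Adj (Two G) a b)
         (sym (h≡ v i)) (sym (h≡ w j)) (mk⇔ forth back)
  where
  σ : Bool → Aut G
  σ b = if b then σ₁ else σ₀
  forth : Adj G v w × i ≡ j →
          Adj G (autFun G (σ i) v) (autFun G (σ j) w) × Inverse.to π i ≡ Inverse.to π j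
  forth (a , refl) = Equivalence.to (proj₂ (σ i) v w) a , refl
  back : Adj G (autFun G (σ i) v) (autFun G (σ j) w) × Inverse.to π i ≡ Inverse.to π j →
         Adj G v w × i ≡ j
  back (a , πi≡πj) with Injection.injective (Inverse⇒Injection π) πi≡πj
  ... | refl = Equivalence.from (proj₂ (σ i) v w) a , refl

module _ {G : Graph} (connected : Connected G) (v₀ : V G)
         (h : (V G × Bool) ↔ (V G × Bool)) (h-adj : PreservesAdjacency (Two G) (Inverse.to h)) where

  open Inverse h

  private
    copy : V G → Bool → Bool
    copy v i = proj₂ (to (v , i))

    copy-constant : ∀ {v w} → Star (Adj G) v w → ∀ i → copy v i ≡ copy w i
    copy-constant ε       i = refl
    copy-constant (a ◅ s) i = trans (proj₂ (Equivalence.to (h-adj _ _) (a , refl))) (copy-constant s i)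

    π : Bool → Bool
    π = copy v₀

    to-splits : ∀ v i → to (v , i) ≡ (proj₁ (to (v , i)) , π i)
    to-splits v i = cong (proj₁ (to (v , i)) ,_) (copy-constant (connected v v₀) i)

    -- h is onto, so some vertex is sent to the copy not (π false)
    π-injective : π false ≢ π true
    π-injective πf≡πt = ≡not⇒≢ refl (begin
      π false             ≡⟨ π-constant (proj₂ w) ⟨
      π (proj₂ w)         ≡⟨ cong proj₂ (to-splits (proj₁ w) (proj₂ w)) ⟨
      proj₂ (to w)        ≡⟨ cong proj₂ (strictlyInverseˡ _) ⟩
      not (π false)       ∎)
      where
      open ≡-Reasoning
      w : V G × Bool
      w = from (v₀ , not (π false))
      π-constant : ∀ b → π b ≡ π false
      π-constant false = refl
      π-constant true  = sym πf≡πt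

    π-involutive : ∀ b → π (π b) ≡ b
    π-involutive = injective⇒involutive π π-injective

    π-inj : ∀ {a b} → π a ≡ π b → a ≡ b
    π-inj {a} {b} e = trans (sym (π-involutive a)) (trans (cong π e) (π-involutive b))

    σ⃗ σ⃖ : Bool → V G → V G
    σ⃗ i v = proj₁ (to (v , i))
    σ⃖ i w = proj₁ (from (w , π i))

    σ⃖∘σ⃗ : ∀ i v → σ⃖ i (σ⃗ i v) ≡ v
    σ⃖∘σ⃗ i v = cong proj₁ (trans (cong from (sym (to-splits v i))) (strictlyInverseʳ (v , i)))

    σ⃗∘σ⃖ : ∀ i w → σ⃗ i (σ⃖ i w) ≡ w
    σ⃗∘σ⃖ i w = subst (λ b → σ⃗ b (proj₁ p) ≡ w) (π-inj (cong proj₂ e)) (cong proj₁ e)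
      where
      p : V G × Bool
      p = from (w , π i)
      e : (σ⃗ (proj₂ p) (proj₁ p) , π (proj₂ p)) ≡ (w , π i)
      e = trans (sym (to-splits (proj₁ p) (proj₂ p))) (strictlyInverseˡ (w , π i))

    σ : Bool → Aut G
    σ i = mk↔ₛ′ (σ⃗ i) (σ⃖ i) (σ⃗∘σ⃖ i) (σ⃖∘σ⃗ i) , λ x y →
      mk⇔ (λ a → proj₁ (Equivalence.to (h-adj (x , i) (y , i)) (a , refl)))
          (λ a → proj₁ (Equivalence.from (h-adj (x , i) (y , i))
                   (a , trans (copy-constant (connected x v₀) i) (sym (copy-constant (connected y v₀) i)))))

  preservesAdjacency⇒inWreath : InWreath G to
  preservesAdjacency⇒inWreath =
    σ false , σ true , mk↔ₛ′ π π π-involutive π-involutive ,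
    λ { v false → to-splits v false ; v true → to-splits v true }

onSecondCopy : ∀ {G} → Aut G → (V G × Bool) ↔ (V G × Bool)
onSecondCopy {G} (ρ , _) = mk↔ₛ′ (λ (v , i) → (if i then to v else v) , i)
                                 (λ (v , i) → (if i then from v else v) , i)
  (λ { (v , false) → refl ; (v , true) → cong (_, true) (strictlyInverseˡ v) })
  (λ { (v , false) → refl ; (v , true) → cong (_, true) (strictlyInverseʳ v) })
  where open Inverse ρ

onSecondCopy-inWreath : ∀ {G} (ρ : Aut G) → InWreath G (Inverse.to (onSecondCopy ρ))
onSecondCopy-inWreath {G} ρ = (↔-id (V G) , λ x y → ⇔-id _) , ρ , ↔-id Bool ,
                              λ { v false → refl ; v true → refl }

autD-isWreath : ∀ {G} → Connected G → V G → (φ : Iso (D G) (Two G)) → AutDIsWreath G φ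
autD-isWreath {G} connected v₀ φ f = mk⇔
  (λ f-aut → preservesAdjacency⇒inWreath connected v₀ (proj₁ φ ↔-∘ (f ↔-∘ ↔-sym (proj₁ φ)))
               (conjugate-preservesAdjacency {Two G} {D G} (Iso-sym {D G} {Two G} φ) (Inverse.to f) f-aut))
  (λ wreath → PreservesAdjacency-cong (D G) conjugate≗f
                (conjugate-preservesAdjacency {D G} {Two G} φ _ (inWreath⇒preservesAdjacency G _ wreath)))
  where
  open Inverse (proj₁ φ)
  conjugate≗f : ∀ x → from (to (Inverse.to f (from (to x)))) ≡ Inverse.to f x
  conjugate≗f x = trans (strictlyInverseʳ _) (cong (Inverse.to f) (strictlyInverseʳ x))

-- Bipartite graphs

module _ {G : Graph} (bipartite : Bipartite G) where

  private
    c : V G → Bool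
    c = proj₁ bipartite

    recolour : V G × Bool → V G × Bool
    recolour (u , x) = u , x xor c u

    recolour-involutive : ∀ w → recolour (recolour w) ≡ w
    recolour-involutive (u , x) = cong (u ,_) (begin
      (x xor c u) xor c u   ≡⟨ xor-assoc x (c u) (c u) ⟩
      x xor (c u xor c u)   ≡⟨ cong (x xor_) (xor-same (c u)) ⟩
      x xor false           ≡⟨ xor-identityʳ x ⟩
      x                     ∎)
      where open ≡-Reasoning

  double-cover≅two-copies : Iso (D G) (Two G)
  double-cover≅two-copies =
    mk↔ₛ′ recolour recolour recolour-involutive recolour-involutive ,
    λ { (u , x) (v , y) → mk⇔
        (λ (a , x≢y) → a , Equivalence.to (xor-≡-injective x y (proj₂ bipartite u v a)) x≢y)
        (λ (a , e)   → a , Equivalence.from (xor-≡-injective x y (proj₂ bipartite u v a)) e) }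

  nonidentity-aut⇒unstable : (ρ : Aut G) (u : V G) → autFun G ρ u ≢ u → Unstable G
  nonidentity-aut⇒unstable ρ u ρu≢u stable =
    ρu≢u (trans (image (not (c u)) (xor-inverseˡ (c u))) (sym (image (c u) (xor-same (c u)))))
    where
    φ : Iso (D G) (Two G)
    φ = double-cover≅two-copies
    f : (V G × Bool) ↔ (V G × Bool)
    f = ↔-sym (proj₁ φ) ↔-∘ (onSecondCopy ρ ↔-∘ proj₁ φ)
    f-aut : IsAut (D G) f
    f-aut = conjugate-preservesAdjacency {D G} {Two G} φ (Inverse.to (onSecondCopy ρ))
              (inWreath⇒preservesAdjacency G (Inverse.to (onSecondCopy ρ)) (onSecondCopy-inWreath ρ))
    σ : Aut G
    σ = proj₁ (stable (f , f-aut))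
    -- f moves u by ρ in one layer of D(G) and fixes it in the other, while σ acts on both
    image : ∀ x {b} → x xor c u ≡ b → (if b then autFun G ρ u else u) ≡ autFun G σ u
    image x refl = cong proj₁ (proj₂ (proj₂ (stable (f , f-aut))) u x)

trivialInstability⇔bipartite : ∀ {G} → Connected G → VertexDetermining G → Dec (Bipartite G) →
                               (Bipartite G → Unstable G) → TriviallyUnstable G ⇔ Bipartite G
trivialInstability⇔bipartite connected determining bipartite? bipartite⇒unstable = mk⇔
  (λ (_ , nontrivial→⊥) →
     decidable-stable bipartite? (λ ¬bip → nontrivial→⊥ (connected , ¬bip , determining)))
  (λ bip → bipartite⇒unstable bip , λ (_ , ¬bip , _) → ¬bip bip)

-- Shifts in ℤₙ

module _ {n : ℕ} .{{_ : NonZero n}} where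

  [m%n+o]%n≡[m+o]%n : ∀ m o → (m % n + o) % n ≡ (m + o) % n
  [m%n+o]%n≡[m+o]%n m o = begin
    (m % n + o) % n           ≡⟨ %-distribˡ-+ (m % n) o n ⟩
    (m % n % n + o % n) % n   ≡⟨ cong (λ r → (r + o % n) % n) (m%n%n≡m%n m n) ⟩
    (m % n + o % n) % n       ≡⟨ %-distribˡ-+ m o n ⟨
    (m + o) % n               ∎
    where open ≡-Reasoning

  [m+s]%n≢m : ∀ {m s} → m < n → 0 < s → s < n → (m + s) % n ≢ m
  [m+s]%n≢m {m} {s} m<n 0<s s<n eq with m + s <? n
  ... | yes m+s<n = <⇒≢ (m<m+n m 0<s) (sym (trans (sym (m<n⇒m%n≡m m+s<n)) eq))
  ... | no  m+s≮n = <⇒≢ s<n (sym (+-cancelˡ-≡ m n s (begin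
    m + n               ≡⟨ cong (_+ n) wrapped ⟨
    m + s ∸ n + n       ≡⟨ m∸n+n≡m n≤m+s ⟩
    m + s               ∎)))
    where
    open ≡-Reasoning
    n≤m+s : n ≤ m + s
    n≤m+s = ≮⇒≥ m+s≮n
    wrapped : m + s ∸ n ≡ m
    wrapped = begin
      m + s ∸ n           ≡⟨ m<n⇒m%n≡m (m<n+o⇒m∸n<o (m + s) n (+-mono-< m<n s<n)) ⟨
      (m + s ∸ n) % n     ≡⟨ m≤n⇒[n∸m]%m≡n%m n≤m+s ⟩
      (m + s) % n         ≡⟨ eq ⟩
      m                   ∎

  shift : ℕ → Fin n → Fin n
  shift s i = fromℕ< (m%n<n (toℕ i + s) n)

  toℕ-shift : ∀ s i → toℕ (shift s i) ≡ (toℕ i + s) % n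
  toℕ-shift s i = toℕ-fromℕ< (m%n<n (toℕ i + s) n)

  StepMod⇔≡shift : ∀ s i j → StepMod n s i j ⇔ j ≡ shift s i
  StepMod⇔≡shift s i j = mk⇔ (λ e → toℕ-injective (trans e (sym (toℕ-shift s i))))
                               (λ j≡ → trans (cong toℕ j≡) (toℕ-shift s i))

  shift-+ : ∀ s t i → shift s (shift t i) ≡ shift (s + t) i
  shift-+ s t i = toℕ-injective (begin
    toℕ (shift s (shift t i))    ≡⟨ toℕ-shift s (shift t i) ⟩
    (toℕ (shift t i) + s) % n    ≡⟨ cong (λ r → (r + s) % n) (toℕ-shift t i) ⟩
    ((toℕ i + t) % n + s) % n    ≡⟨ [m%n+o]%n≡[m+o]%n (toℕ i + t) s ⟩
    (toℕ i + t + s) % n          ≡⟨ cong (_% n) (+-assoc (toℕ i) t s) ⟩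
    (toℕ i + (t + s)) % n        ≡⟨ cong (λ r → (toℕ i + r) % n) (+-comm t s) ⟩
    (toℕ i + (s + t)) % n        ≡⟨ toℕ-shift (s + t) i ⟨
    toℕ (shift (s + t) i)        ∎)
    where open ≡-Reasoning

  shift-comm : ∀ s t i → shift s (shift t i) ≡ shift t (shift s i)
  shift-comm s t i = trans (shift-+ s t i) (trans (cong (λ r → shift r i) (+-comm s t)) (sym (shift-+ t s i)))

  StepMod-shift : ∀ t {s i j} → StepMod n s i j → StepMod n s (shift t i) (shift t j)
  StepMod-shift t {s} {i} {j} e = Equivalence.from (StepMod⇔≡shift s (shift t i) (shift t j))
    (trans (cong (shift t) (Equivalence.to (StepMod⇔≡shift s i j) e)) (shift-comm t s i))

  shift-0 : ∀ i → shift 0 i ≡ i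
  shift-0 i = toℕ-injective
    (trans (toℕ-shift 0 i) (trans (cong (_% n) (+-identityʳ (toℕ i))) (m<n⇒m%n≡m (toℕ<n i))))

  shift-n : ∀ i → shift n i ≡ i
  shift-n i = toℕ-injective
    (trans (toℕ-shift n i) (trans ([m+n]%n≡m%n (toℕ i) n) (m<n⇒m%n≡m (toℕ<n i))))

  shift-inverseʳ : ∀ i → shift (n ∸ 1) (shift 1 i) ≡ i
  shift-inverseʳ i = trans (shift-+ (n ∸ 1) 1 i)
    (trans (cong (λ r → shift r i) (m∸n+n≡m (>-nonZero⁻¹ n))) (shift-n i))

  shift-inverseˡ : ∀ i → shift 1 (shift (n ∸ 1) i) ≡ i
  shift-inverseˡ i = trans (shift-comm 1 (n ∸ 1) i) (shift-inverseʳ i)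

  shift≢id : ∀ {s} → 0 < s → s < n → ∀ i → shift s i ≢ i
  shift≢id 0<s s<n i e = [m+s]%n≢m (toℕ<n i) 0<s s<n (trans (sym (toℕ-shift _ i)) (cong toℕ e))

  0ₙ : Fin n
  0ₙ = fromℕ< (>-nonZero⁻¹ n)

  shift-from-0 : ∀ i → shift (toℕ i) 0ₙ ≡ i
  shift-from-0 i = toℕ-injective (begin
    toℕ (shift (toℕ i) 0ₙ)   ≡⟨ toℕ-shift (toℕ i) 0ₙ ⟩
    (toℕ 0ₙ + toℕ i) % n      ≡⟨ cong (λ r → (r + toℕ i) % n) (toℕ-fromℕ< (>-nonZero⁻¹ n)) ⟩
    toℕ i % n                 ≡⟨ m<n⇒m%n≡m (toℕ<n i) ⟩
    toℕ i                     ∎)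
    where open ≡-Reasoning

  isOdd-shift : 2 ∣ n → ∀ s → isOdd s ≡ true →
                ∀ i → isOdd (toℕ (shift s i)) ≡ not (isOdd (toℕ i))
  isOdd-shift 2∣n s odd i = begin
    isOdd (toℕ (shift s i))           ≡⟨ cong isOdd (toℕ-shift s i) ⟩
    isOdd ((toℕ i + s) % n)           ≡⟨ isOdd-% (toℕ i + s) n 2∣n ⟩
    isOdd (toℕ i + s)                 ≡⟨ isOdd-+ (toℕ i) s ⟩
    isOdd (toℕ i) xor isOdd s         ≡⟨ cong (isOdd (toℕ i) xor_) odd ⟩
    isOdd (toℕ i) xor true            ≡⟨ not-distribʳ-xor (isOdd (toℕ i)) false ⟨
    not (isOdd (toℕ i) xor false)     ≡⟨ cong not (xor-identityʳ _) ⟩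
    not (isOdd (toℕ i))               ∎
    where open ≡-Reasoning

-- The generalized Petersen graph

module _ (n k : ℕ) .{{_ : NonZero n}} where

  private
    step : ∀ s i → StepMod n s i (shift s i)
    step s i = Equivalence.from (StepMod⇔≡shift s i (shift s i)) refl

  GPAdj-sym : ∀ {x y} → GPAdj n k x y → GPAdj n k y x
  GPAdj-sym {false , _} {false , _} (inj₁ e) = inj₂ e
  GPAdj-sym {false , _} {false , _} (inj₂ e) = inj₁ e
  GPAdj-sym {false , _} {true  , _} e        = sym e
  GPAdj-sym {true  , _} {false , _} e        = sym e
  GPAdj-sym {true  , _} {true  , _} (inj₁ e) = inj₂ e
  GPAdj-sym {true  , _} {true  , _} (inj₂ e) = inj₁ e

  rotate : ℕ → Bool × Fin n → Bool × Fin n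
  rotate t (b , i) = b , shift t i

  rotate-preservesAdj : ∀ t {x y} → GPAdj n k x y → GPAdj n k (rotate t x) (rotate t y)
  rotate-preservesAdj t {false , i} {false , j} (inj₁ e) = inj₁ (StepMod-shift t e)
  rotate-preservesAdj t {false , i} {false , j} (inj₂ e) = inj₂ (StepMod-shift t e)
  rotate-preservesAdj t {false , i} {true  , j} refl     = refl
  rotate-preservesAdj t {true  , i} {false , j} refl     = refl
  rotate-preservesAdj t {true  , i} {true  , j} (inj₁ e) = inj₁ (StepMod-shift t e)
  rotate-preservesAdj t {true  , i} {true  , j} (inj₂ e) = inj₂ (StepMod-shift t e)

  rotation : Aut (GP n k)
  rotation = mk↔ₛ′ (rotate 1) (rotate (n ∸ 1)) (λ (b , i) → cong (b ,_) (shift-inverseˡ i))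
                                              (λ (b , i) → cong (b ,_) (shift-inverseʳ i)) ,
    λ x y → mk⇔ (rotate-preservesAdj 1)
      (λ a → subst₂ (GPAdj n k) (back x) (back y) (rotate-preservesAdj (n ∸ 1) a))
    where
    back : ∀ x → rotate (n ∸ 1) (rotate 1 x) ≡ x
    back (b , i) = cong (b ,_) (shift-inverseʳ i)

  rim : Fin n → ℕ → Bool × Fin n
  rim i m = false , shift m i

  rim-adjacent : ∀ i m → GPAdj n k (rim i m) (rim i (suc m))
  rim-adjacent i m = inj₁ (subst (StepMod n 1 (shift m i)) (shift-+ 1 m i) (step 1 (shift m i)))

  GP-connected : Connected (GP n k)
  GP-connected = connected-from (GP n k) GPAdj-sym (false , 0ₙ) reach
    where
    reach-rim : ∀ i → Star (GPAdj n k) (false , 0ₙ) (false , i)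
    reach-rim i = subst₂ (λ j j′ → Star (GPAdj n k) (false , j) (false , j′))
                         (shift-0 0ₙ) (shift-from-0 i) (walk (GP n k) (rim 0ₙ) (rim-adjacent 0ₙ) (toℕ i))
    reach : ∀ v → Star (GPAdj n k) (false , 0ₙ) v
    reach (false , i) = reach-rim i
    reach (true  , i) = reach-rim i ◅◅ (refl ◅ ε)

  rotation-moves : 2 ≤ n → ∀ x → autFun (GP n k) rotation x ≢ x
  rotation-moves 2≤n (b , i) e = shift≢id (s≤s z≤n) 2≤n i (cong proj₂ e)

  -- v_j would be adjacent to both u_{i+1} and u_{i-1}, forcing i + 2 ≡ i (mod n)
  rim-nbhd⊈inner-nbhd : 3 ≤ n → ∀ i j → ¬ (∀ w → GPAdj n k (false , i) w → GPAdj n k (true , j) w)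
  rim-nbhd⊈inner-nbhd 3≤n i j ⊆ = shift≢id (s≤s z≤n) 3≤n i (begin
    shift 2 i                  ≡⟨ shift-+ 1 1 i ⟨
    shift 1 (shift 1 i)        ≡⟨ cong (shift 1) (trans (sym j≡i+1) j≡i-1) ⟩
    shift 1 (shift (n ∸ 1) i)  ≡⟨ shift-inverseˡ i ⟩
    i                          ∎)
    where
    open ≡-Reasoning
    j≡i+1 : j ≡ shift 1 i
    j≡i+1 = ⊆ (false , shift 1 i) (inj₁ (step 1 i))
    j≡i-1 : j ≡ shift (n ∸ 1) i
    j≡i-1 = ⊆ (false , shift (n ∸ 1) i)
              (inj₂ (subst (StepMod n 1 (shift (n ∸ 1) i)) (shift-inverseˡ i) (step 1 (shift (n ∸ 1) i))))

  GP-vertexDetermining : 3 ≤ n → VertexDetermining (GP n k)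
  GP-vertexDetermining 3≤n (false , i) (false , j) same =
    cong (false ,_) (sym (Equivalence.to (same (true , i)) refl))
  GP-vertexDetermining 3≤n (true  , i) (true  , j) same =
    cong (true ,_) (sym (Equivalence.to (same (false , i)) refl))
  GP-vertexDetermining 3≤n (false , i) (true  , j) same =
    ⊥-elim (rim-nbhd⊈inner-nbhd 3≤n i j (Equivalence.to ∘ same))
  GP-vertexDetermining 3≤n (true  , j) (false , i) same =
    ⊥-elim (rim-nbhd⊈inner-nbhd 3≤n i j (Equivalence.from ∘ same))

  GP-bipartite⇒ : Bipartite (GP n k) → 2 ∣ n × ¬ 2 ∣ k
  GP-bipartite⇒ (c , proper) = n-even , k-odd
    where
    open ≡-Reasoning
    c₀ : Bool
    c₀ = c (false , 0ₙ)
    along-rim : ∀ m → c (false , shift m 0ₙ) ≡ c₀ xor isOdd m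
    along-rim m = trans (colour-alternates (GP n k) (c , proper) (rim 0ₙ) (rim-adjacent 0ₙ) m)
                        (cong (λ j → c (false , j) xor isOdd m) (shift-0 0ₙ))
    n-even : 2 ∣ n
    n-even = isOdd≡false⇒2∣ n (x⊕y≡x⇒y≡false c₀ (isOdd n)
               (trans (sym (along-rim n)) (cong (λ j → c (false , j)) (shift-n 0ₙ))))
    spoke : ∀ i → c (true , i) ≡ not (c (false , i))
    spoke i = ¬-not (≢-sym (proper (false , i) (true , i) refl))
    k-odd : ¬ 2 ∣ k
    k-odd 2∣k = proper (true , 0ₙ) (true , shift k 0ₙ) (inj₁ (step k 0ₙ)) (begin
      c (true , 0ₙ)                  ≡⟨ spoke 0ₙ ⟩
      not c₀                         ≡⟨ cong not (xor-identityʳ c₀) ⟨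
      not (c₀ xor false)             ≡⟨ cong (λ b → not (c₀ xor b)) (2∣⇒isOdd≡false 2∣k) ⟨
      not (c₀ xor isOdd k)           ≡⟨ cong not (along-rim k) ⟨
      not (c (false , shift k 0ₙ))   ≡⟨ spoke (shift k 0ₙ) ⟨
      c (true , shift k 0ₙ)          ∎)

  GP-colouring : 2 ∣ n → ¬ 2 ∣ k → Bipartite (GP n k)
  GP-colouring 2∣n k-odd = colour , proper
    where
    colour : Bool × Fin n → Bool
    colour (b , i) = b xor isOdd (toℕ i)
    isOdd-k : isOdd k ≡ true
    isOdd-k = ¬2∣⇒isOdd≡true k k-odd
    along : ∀ s → isOdd s ≡ true → ∀ b i j → StepMod n s i j → colour (b , i) ≢ colour (b , j)
    along s odd b i j e = ≡not⇒≢ (begin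
      colour (b , j)                 ≡⟨ cong (colour ∘ (b ,_)) (Equivalence.to (StepMod⇔≡shift s i j) e) ⟩
      b xor isOdd (toℕ (shift s i))  ≡⟨ cong (b xor_) (isOdd-shift 2∣n s odd i) ⟩
      b xor not (isOdd (toℕ i))      ≡⟨ not-distribʳ-xor b _ ⟨
      not (colour (b , i))           ∎)
      where open ≡-Reasoning
    proper : ∀ u v → GPAdj n k u v → colour u ≢ colour v
    proper (false , i) (false , j) (inj₁ e) = along 1 refl false i j e
    proper (false , i) (false , j) (inj₂ e) = ≢-sym (along 1 refl false j i e)
    proper (false , i) (true  , j) refl     = ≡not⇒≢ refl
    proper (true  , i) (false , j) refl     = ≢-sym (≡not⇒≢ refl)
    proper (true  , i) (true  , j) (inj₁ e) = along k isOdd-k true i j e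
    proper (true  , i) (true  , j) (inj₂ e) = ≢-sym (along k isOdd-k true j i e)

  GP-bipartite⇔ : Bipartite (GP n k) ⇔ (2 ∣ n × ¬ 2 ∣ k)
  GP-bipartite⇔ = mk⇔ GP-bipartite⇒ (λ (2∣n , k-odd) → GP-colouring 2∣n k-odd)

proposition4p1 : (n k : ℕ) .{{_ : NonZero n}} → 1 ≤ k → 2 * k < n →
    (TriviallyUnstable (GP n k) ⇔ Bipartite (GP n k))
    × (Bipartite (GP n k) ⇔ (2 ∣ n × ¬ 2 ∣ k))
    × (2 ∣ n → ¬ 2 ∣ k →
        Σ (Iso (D (GP n k)) (Two (GP n k))) λ φ → AutDIsWreath (GP n k) φ)
proposition4p1 n k 1≤k 2k<n =
    trivialInstability⇔bipartite (GP-connected n k) (GP-vertexDetermining n k 3≤n) bipartite?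
      (λ bip → nonidentity-aut⇒unstable bip (rotation n k) u₀ (rotation-moves n k (<⇒≤ 3≤n) u₀))
  , GP-bipartite⇔ n k
  , λ 2∣n k-odd → let φ = double-cover≅two-copies (GP-colouring n k 2∣n k-odd) in
                  φ , autD-isWreath (GP-connected n k) u₀ φ
  where
  3≤n : 3 ≤ n
  3≤n = ≤-<-trans (*-monoʳ-≤ 2 1≤k) 2k<n
  u₀ : Bool × Fin n
  u₀ = false , 0ₙ
  bipartite? : Dec (Bipartite (GP n k))
  bipartite? = Dec.map (⇔-sym (GP-bipartite⇔ n k)) ((2 ∣? n) ×-dec ¬? (2 ∣? k))
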